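{- Let $(\mathcal{X},\mathcal{F})$ be a SET-COVER instance and $\mathbb{G}$ its reduction graph (for $k=3$) as described in the context. If $E'$ is a good 3-completion set of $\mathbb{G}$, then $\{S_j\in\mathcal{F} : (S_j,P)\in E'\}$ is a subfamily of $\mathcal{F}$ of size $|E'|$ whose union is $\mathcal{X}$.
   Context: A SET-COVER instance consists of a finite set $\mathcal{X}=\{x_1,\dots,x_{|\mathcal X|}\}$ of items and a family $\mathcal{F}=\{S_1,\dots,S_{|\mathcal F|}\}$ of nonempty subsets of $\mathcal{X}$ whose union is $\mathcal{X}$. The reduction graph $\mathbb{G}$ is built as follows: add one vertex $S_j$ (set vertex) for each $S_j\in\mathcal F$; for each item $x_i$ add a set $I_i$ of $2|\mathcal X|$ new pairwise non-adjacent vertices; for each $x_i$ and $S_j$ with $x_i\in S_j$, join $S_j$ to every vertex of $I_i$; for every edge $(S_j,v)$ so added, add a new vertex $w$ adjacent to both $S_j$ and $v$; finally add a vertex $P$ adjacent to every vertex of every $I_i$. A 3-completion set of a graph $G=(V,E)$ is a set $E'$ of non-edges such that every edge of $(V,E\cup E')$ lies in a triangle. A good 3-completion set of $\mathbb{G}$ is a 3-completion set $E'$ with $E'\subseteq \{(S_j,P): S_j\in\mathcal F\}$. -}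

module Defs where

open import Data.Nat using (ℕ; _*_)
open import Data.Fin using (Fin)
open import Data.Fin.Subset using (Subset; _∈_; Nonempty)
open import Data.Product using (Σ; ∃; _×_; _,_)
open import Data.Sum using (_⊎_)
open import Relation.Binary.PropositionalEquality using (_≡_)

record SetCover : Set where
  field
    n m      : ℕ
    S        : Fin m → Subset n
    nonempty : ∀ j → Nonempty (S j)
    covers   : ∀ (i : Fin n) → ∃ λ j → i ∈ S j
    -- F is a set: its members are pairwise distinct
    distinct : ∀ {j j′} → S j ≡ S j′ → j ≡ j′

module Reduction (I : SetCover) where
  open SetCover I

  -- Vertices of the reduction graph 𝔾.
  --   setV j        : the set vertex S_j
  --   itemV i a     : the a-th vertex of I_i   (|I_i| = 2|X| = 2 * n)
  --   wV j i a p    : the extra vertex w added for the edge (S_j , itemV i a),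
  --                   which exists exactly when x_i ∈ S_j (witness p)
  --   P             : the vertex P
  data Vertex : Set where
    setV  : Fin m → Vertex
    itemV : Fin n → Fin (2 * n) → Vertex
    wV    : (j : Fin m) (i : Fin n) (a : Fin (2 * n)) → i ∈ S j → Vertex
    P     : Vertex

  -- Oriented description of the edges of 𝔾.
  data Arc : Vertex → Vertex → Set where
    set-item : ∀ {j i a} → i ∈ S j → Arc (setV j) (itemV i a)
    w-set    : ∀ {j i a} (p : i ∈ S j) → Arc (wV j i a p) (setV j)
    w-item   : ∀ {j i a} (p : i ∈ S j) → Arc (wV j i a p) (itemV i a)
    P-item   : ∀ {i a} → Arc P (itemV i a)

  Adj : Vertex → Vertex → Set
  Adj u v = Arc u v ⊎ Arc v u

  -- A good set of added non-edges E' ⊆ {(S_j , P)} is determined by the subset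
  -- D ⊆ F of indices j with (S_j , P) ∈ E'; |E'| = ∣ D ∣.
  -- The added edges of E' (undirected):
  Added : Subset m → Vertex → Vertex → Set
  Added D u v = (∃ λ j → j ∈ D × u ≡ setV j × v ≡ P)
              ⊎ (∃ λ j → j ∈ D × u ≡ P × v ≡ setV j)

  Adj⁺ : Subset m → Vertex → Vertex → Set
  Adj⁺ D u v = Adj u v ⊎ Added D u v

  NonEdges : Subset m → Set
  NonEdges D = ∀ u v → Added D u v → Adj u v → Data.Empty.⊥
    where import Data.Empty

  -- E' is a 3-completion set: every edge of (V, E ∪ E') lies in a triangle.
  -- (Both graphs are loopless, so a common neighbour w is distinct from u, v.)
  Is3Completion : Subset m → Set
  Is3Completion D = NonEdges D ×
    (∀ u v → Adj⁺ D u v → ∃ λ w → Adj⁺ D u w × Adj⁺ D v w)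

{-# OPTIONS --safe #-}
module Submission where

-- The edge between P and an item vertex of I_i must lie in a triangle.  The
-- neighbours of P in the completed graph are the item vertices, which are
-- pairwise non-adjacent, and the set vertices S_j with (S_j , P) ∈ E′; so the
-- third vertex of the triangle is such an S_j, and being adjacent to a vertex
-- of I_i it contains x_i.

open import Defs
open import Data.Empty using (⊥-elim)
open import Data.Fin using (Fin; _↑ˡ_)
open import Data.Nat using (_*_)
open import Data.Fin.Subset using (Subset; _∈_)
open import Data.Product using (∃; _×_; _,_)
open import Data.Sum using (inj₁; inj₂)
open import Relation.Binary.PropositionalEquality using (refl)
open import Relation.Nullary using (¬_)

module _ (I : SetCover) (D : Subset (SetCover.m I)) where
  open SetCover I
  open Reduction I

  data NeighbourOfP : Vertex → Set where
    item : ∀ i a → NeighbourOfP (itemV i a)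
    set  : ∀ {j} → j ∈ D → NeighbourOfP (setV j)

  neighbourOfP : ∀ {w} → Adj⁺ D P w → NeighbourOfP w
  neighbourOfP (inj₁ (inj₁ P-item))                  = item _ _
  neighbourOfP (inj₁ (inj₂ ()))
  neighbourOfP (inj₂ (inj₁ (_ , _ , () , _)))
  neighbourOfP (inj₂ (inj₂ (_ , j∈D , refl , refl))) = set j∈D

  itemV-itemV-nonadjacent : ∀ {i a i′ a′} → ¬ Adj⁺ D (itemV i a) (itemV i′ a′)
  itemV-itemV-nonadjacent (inj₁ (inj₁ ()))
  itemV-itemV-nonadjacent (inj₁ (inj₂ ()))
  itemV-itemV-nonadjacent (inj₂ (inj₁ (_ , _ , () , _)))
  itemV-itemV-nonadjacent (inj₂ (inj₂ (_ , _ , () , _)))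

  itemV-setV-adjacent⇒∈ : ∀ {i a j} → Adj⁺ D (itemV i a) (setV j) → i ∈ S j
  itemV-setV-adjacent⇒∈ (inj₁ (inj₁ ()))
  itemV-setV-adjacent⇒∈ (inj₁ (inj₂ (set-item i∈Sj)))  = i∈Sj
  itemV-setV-adjacent⇒∈ (inj₂ (inj₁ (_ , _ , () , _)))
  itemV-setV-adjacent⇒∈ (inj₂ (inj₂ (_ , _ , () , _)))

  triangle-P-itemV⇒covered : ∀ {i a w} → Adj⁺ D P w → Adj⁺ D (itemV i a) w →
                             ∃ λ j → j ∈ D × i ∈ S j
  triangle-P-itemV⇒covered P~w itemV~w with neighbourOfP P~w
  ... | item _ _    = ⊥-elim (itemV-itemV-nonadjacent itemV~w)
  ... | set {j} j∈D = j , j∈D , itemV-setV-adjacent⇒∈ itemV~w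

lemma1 : (I : SetCover) (D : Subset (SetCover.m I)) →
    Reduction.Is3Completion I D →
    (∀ i → ∃ λ j → j ∈ D × i ∈ SetCover.S I j)
lemma1 I D (_ , triangle) i =
  let _ , P~w , itemV~w = triangle P (itemV i a) (inj₁ (inj₁ P-item))
  in  triangle-P-itemV⇒covered I D P~w itemV~w
  where
  open Reduction I
  -- I_i has 2n ≥ n vertices, so the index of x_i also names one of them.
  a : Fin (2 * SetCover.n I)
  a = i ↑ˡ _
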